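{- Let $r,t\in\mathbb{N}$ and let $G$ be a graph of radius at most $r$. Let $S\subseteq V(G)$. If $|S|\ge t^r+1$, then there exists $u\in V(G)$ such that there are $t$ vertices in $S$ which are distinct from $u$ and can be reached from $u$ by internally vertex-disjoint paths of length at most $r$.
   Context: Graphs are finite, simple, undirected. The length of a path is its number of edges. The radius of a connected graph $G$ is the minimum $r$ such that for some vertex $v$ all vertices are at distance at most $r$ from $v$; a disconnected graph has radius $+\infty$. -}

module Defs where

open import Level using (0ℓ)
open import Data.Nat using (ℕ; _≤_; _∸_)
open import Data.Fin using (Fin)
open import Data.List using (List; []; _∷_; length)
open import Data.List.Relation.Unary.Unique.Propositional using (Unique)
open import Data.Product using (Σ; ∃; _×_; _,_)
open import Relation.Binary.PropositionalEquality using (_≡_)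
open import Relation.Nullary using (¬_)

record Graph (n : ℕ) : Set₁ where
  field
    Adj    : Fin n → Fin n → Set
    sym    : ∀ {a b} → Adj a b → Adj b a
    irrefl : ∀ {a} → ¬ Adj a a
open Graph public

data Walk {n : ℕ} (G : Graph n) : Fin n → Fin n → List (Fin n) → Set where
  here : (a : Fin n) → Walk G a a (a ∷ [])
  step : ∀ {a b c vs} → Adj G a b → Walk G b c vs → Walk G a c (a ∷ vs)

IsPath : {n : ℕ} → Graph n → Fin n → Fin n → List (Fin n) → Set
IsPath G a b vs = Walk G a b vs × Unique vs

pathLength : {n : ℕ} → List (Fin n) → ℕ
pathLength vs = length vs ∸ 1

DistLe : {n : ℕ} → Graph n → Fin n → Fin n → ℕ → Set
DistLe G a b r = Σ (List _) λ vs → IsPath G a b vs × pathLength vs ≤ r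

-- radius(G) ≤ r : some vertex v has every vertex at distance ≤ r
-- (a disconnected graph has infinite radius and never satisfies this).
RadiusLe : {n : ℕ} → Graph n → ℕ → Set
RadiusLe {n} G r = ∃ λ (v : Fin n) → (w : Fin n) → DistLe G v w r

-- Let rank x be the earliest position at which x occurs on one of the walks of length ≤ r from
-- the centre v.  Every x ≢ v has a neighbour of smaller rank (its predecessor on a walk attaining
-- the rank); choosing one as parent gives a spanning tree of height ≤ r rooted at v.  Descend from
-- the root: if the subtree of u, down to k further levels, contains more than t^k vertices of S,
-- then, discarding u itself, either t different branches below u contain one of them, and the tree
-- paths from u to one such vertex per branch form the fan, or by pigeonhole some branch contains
-- more than t^(k-1) of them and we descend into it.

module Submission where

open import Defs hiding (sym)
open import Data.Nat using (ℕ; zero; suc; _≤_; _<_; _^_; _+_; _*_; z≤n; s≤s; s≤s⁻¹)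
open import Data.Nat.Properties
  using (≤-refl; ≤-trans; ≤-reflexive; <-trans; <⇒≤; ≤-<-trans; <-≤-trans; <⇒≱; <-asym;
         n<1+n; n≤1+n; ≮⇒≥; _<?_; +-comm; +-suc; +-monoˡ-≤; +-cancelˡ-<; m<n+m; m^n>0;
         ∸-monoˡ-≤; module ≤-Reasoning)
open import Data.Fin using (Fin; zero; suc; _≟_)
open import Data.Fin.Properties using (suc-injective)
open import Data.Fin.Subset using (Subset; _∈_; ∣_∣; inside; outside)
open import Data.Maybe using (fromMaybe)
open import Data.List using (List; []; _∷_; _++_; _∷ʳ_; length; map; filter; drop; head; allFin;
                             initLast; _∷ʳ′_)
open import Data.List.Properties
  using (length-++; length-map; ++-assoc; ++-identityʳ; ∷ʳ-injective; filter-all)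
open import Data.List.Membership.Propositional using () renaming (_∈_ to _∈ˡ_)
open import Data.List.Membership.Propositional.Properties
  using (∈-filter⁻; ∈-allFin; ∈-map⁻; ∈-∃++)
open import Data.List.Relation.Unary.Any using (here; there)
open import Data.List.Relation.Unary.All as All using (All; []; _∷_)
import Data.List.Relation.Unary.All.Properties as All
open import Data.List.Relation.Unary.AllPairs using ([]; _∷_)
open import Data.List.Relation.Unary.Unique.Propositional using (Unique)
import Data.List.Relation.Unary.Unique.Propositional.Properties as Unique
open import Data.List.Relation.Binary.Sublist.Propositional.Properties
  using (filter-⊆; filter⁺; length-mono-≤)
import Data.List.Extrema
open import Data.Vec.Base using ([]; _∷_; here; there)
import Data.Vec.Functional as Vector
open import Data.Product using (Σ; ∃; _×_; _,_; proj₁; proj₂)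
open import Data.Sum using (_⊎_; inj₁; inj₂)
open import Function using (_∘_)
open import Function.Definitions using (Injective)
open import Induction.WellFounded using (Acc; acc)
open import Data.Nat.Induction using (<-wellFounded)
open import Relation.Nullary using (yes; no; ¬?; contradiction)
open import Relation.Unary using (Pred; Decidable)
open import Relation.Unary.Properties using (∁?)
open import Relation.Binary.Definitions using (DecidableEquality)
open import Relation.Binary.PropositionalEquality
  using (_≡_; _≢_; refl; sym; trans; cong; subst; module ≡-Reasoning)

open Data.List.Extrema Data.Nat.Properties.≤-totalOrder using (argmin; f[argmin]≤f[xs])

module _ {a p} {A : Set a} {P : Pred A p} (P? : Decidable P) where

  length-filter+∁ : ∀ xs → length xs ≡ length (filter P? xs) + length (filter (∁? P?) xs)
  length-filter+∁ [] = refl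
  length-filter+∁ (x ∷ xs) with P? x
  ... | yes _ = cong suc (length-filter+∁ xs)
  ... | no _ = trans (cong suc (length-filter+∁ xs)) (sym (+-suc _ _))

module _ {a} {A : Set a} (_≟ᴬ_ : DecidableEquality A) where

  length-filter-≢ : ∀ u {xs} → Unique xs → length xs ≤ suc (length (filter (λ s → ¬? (s ≟ᴬ u)) xs))
  length-filter-≢ u {[]} _ = z≤n
  length-filter-≢ u {s ∷ xs} (s∉xs ∷ uniq) with s ≟ᴬ u
  ... | yes refl = s≤s (≤-reflexive (sym (cong length
                     (filter-all (λ s → ¬? (s ≟ᴬ u)) (All.map (λ s≢y y≡s → s≢y (sym y≡s)) s∉xs)))))
  ... | no _ = s≤s (length-filter-≢ u uniq)

  -- When x ∉ xs the result is length xs + K, so a value below K witnesses x ∈ xs.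
  position : ℕ → A → List A → ℕ
  position K x [] = K
  position K x (y ∷ ys) with x ≟ᴬ y
  ... | yes _ = 0
  ... | no _ = suc (position K x ys)

  position-here : ∀ K x ys → position K x (x ∷ ys) ≡ 0
  position-here K x ys with x ≟ᴬ x
  ... | yes _ = refl
  ... | no x≢x = contradiction refl x≢x

  position-there : ∀ K {x y} ys → x ≢ y → position K x (y ∷ ys) ≡ suc (position K x ys)
  position-there K {x} {y} ys x≢y with x ≟ᴬ y
  ... | yes x≡y = contradiction x≡y x≢y
  ... | no _ = refl

  position-∷ : ∀ K x y ys → position K x (y ∷ ys) ≤ suc (position K x ys)
  position-∷ K x y ys with x ≟ᴬ y
  ... | yes _ = z≤n
  ... | no _ = ≤-refl

  position<length : ∀ K {x xs} → x ∈ˡ xs → position K x xs < length xs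
  position<length K {x} {y ∷ ys} x∈xs with x ≟ᴬ y | x∈xs
  ... | yes _ | _ = s≤s z≤n
  ... | no x≢y | here x≡y = contradiction x≡y x≢y
  ... | no _ | there x∈ys = s≤s (position<length K x∈ys)

drop-length-++ : ∀ {a} {A : Set a} (xs : List A) {ys} → drop (length xs) (xs ++ ys) ≡ ys
drop-length-++ [] = refl
drop-length-++ (_ ∷ xs) = drop-length-++ xs

module Pigeonhole {a b} {A : Set a} {B : Set b} (_≟ᴮ_ : DecidableEquality B) (κ : A → B) where

  class : B → List A → List A
  class c = filter (λ s → κ s ≟ᴮ c)

  LargeClass : ℕ → List A → Set _
  LargeClass m xs = ∃ λ c → m < length (class c xs)

  DistinctKeys : ℕ → List A → Set _
  DistinctKeys t xs = ∃ λ (g : Fin t → A) → (∀ i → g i ∈ˡ xs) × Injective _≡_ _≡_ (κ ∘ g)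

  pigeonhole : ∀ j m xs → j * m < length xs → LargeClass m xs ⊎ DistinctKeys (suc j) xs
  pigeonhole j m [] ()
  pigeonhole zero m (s ∷ xs) _ = inj₂ ((λ _ → s) , (λ _ → here refl) , λ { {zero} {zero} _ → refl })
  pigeonhole (suc j) m (s ∷ xs) lt with m <? length (class (κ s) (s ∷ xs))
  ... | yes large = inj₁ (κ s , large)
  ... | no small = extend (pigeonhole j m others enough)
    where
      same? = λ y → κ y ≟ᴮ κ s
      others = filter (∁? same?) (s ∷ xs)

      enough : j * m < length others
      enough = +-cancelˡ-< m (j * m) (length others) (begin-strict
        m + j * m                                         <⟨ lt ⟩
        length (s ∷ xs)                                   ≡⟨ length-filter+∁ same? (s ∷ xs) ⟩
        length (class (κ s) (s ∷ xs)) + length others     ≤⟨ +-monoˡ-≤ (length others) (≮⇒≥ small) ⟩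
        m + length others                                 ∎)
        where open ≤-Reasoning

      extend : LargeClass m others ⊎ DistinctKeys (suc j) others →
               LargeClass m (s ∷ xs) ⊎ DistinctKeys (suc (suc j)) (s ∷ xs)
      extend (inj₁ (c , large)) = inj₁ (c , <-≤-trans large (length-mono-≤ class-sublist))
        where
          key≟c = λ y → κ y ≟ᴮ c
          class-sublist = filter⁺ key≟c key≟c (λ { refl κy≡c → κy≡c }) (filter-⊆ (∁? same?) (s ∷ xs))
      extend (inj₂ (g , g∈ , injective)) = inj₂ (s Vector.∷ g , g′∈ , injective′)
        where
          g′∈ : ∀ i → (s Vector.∷ g) i ∈ˡ s ∷ xs
          g′∈ zero = here refl
          g′∈ (suc i) = proj₁ (∈-filter⁻ (∁? same?) (g∈ i))

          new-key : ∀ i → κ (g i) ≢ κ s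
          new-key i = proj₂ (∈-filter⁻ (∁? same?) (g∈ i))

          injective′ : Injective _≡_ _≡_ (κ ∘ (s Vector.∷ g))
          injective′ {zero} {zero} _ = refl
          injective′ {zero} {suc i} eq = contradiction (sym eq) (new-key i)
          injective′ {suc i} {zero} eq = contradiction eq (new-key i)
          injective′ {suc i} {suc i′} eq = cong suc (injective eq)

module _ {n : ℕ} (G : Graph n) where

  walk-last : ∀ {a b xs} → Walk G a b xs → b ∈ˡ xs
  walk-last (here _) = here refl
  walk-last (step _ w) = there (walk-last w)

  walk-head : ∀ {a b xs} → Walk G a b xs → ∃ λ rest → xs ≡ a ∷ rest
  walk-head (here a) = [] , refl
  walk-head (step {vs = vs} _ _) = vs , refl

  walk-snoc : ∀ {a b c xs} → Walk G a b xs → Adj G b c → Walk G a c (xs ∷ʳ c)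
  walk-snoc (here _) e = step e (here _)
  walk-snoc (step e′ w) e = step e′ (walk-snoc w e)

  walk-suffix : ∀ α {a b u xs} → Walk G a b (α ++ u ∷ xs) → Walk G u b (u ∷ xs)
  walk-suffix [] (here _) = here _
  walk-suffix [] (step e w) = step e w
  walk-suffix (_ ∷ []) (step _ w) = walk-suffix [] w
  walk-suffix (_ ∷ y ∷ α) (step _ w) = walk-suffix (y ∷ α) w

  isPath-suffix : ∀ α {a b u xs} → IsPath G a b (α ++ u ∷ xs) → IsPath G u b (u ∷ xs)
  isPath-suffix α (w , uniq) =
    walk-suffix α w , subst Unique (drop-length-++ α) (Unique.drop⁺ (length α) uniq)

  walk-predecessor : ∀ K {a b xs} → Walk G a b xs → ∀ x → x ≢ a → position _≟_ K x xs < K →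
                     ∃ λ y → Adj G y x × position _≟_ K y xs < position _≟_ K x xs
  walk-predecessor K (here a) x x≢a lt
    rewrite position-there _≟_ K [] x≢a = contradiction lt (<-asym (n<1+n K))
  walk-predecessor K (step {a} {b} {vs = vs} e w) x x≢a lt
    rewrite position-there _≟_ K vs x≢a with x ≟ b
  ... | yes refl = a , e , subst (_< suc _) (sym (position-here _≟_ K a vs)) (s≤s z≤n)
  ... | no x≢b with walk-predecessor K w x x≢b (<-trans (n<1+n _) lt)
  ...   | y , y~x , earlier = y , y~x , ≤-<-trans (position-∷ _≟_ K y a vs) (s≤s earlier)

  record Fan (t ℓ : ℕ) (u : Fin n) : Set where
    field
      leaf : Fin t → Fin n
      path : Fin t → List (Fin n)
      leaf-injective : Injective _≡_ _≡_ leaf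
      leaf≢centre : ∀ i → leaf i ≢ u
      path-isPath : ∀ i → IsPath G u (leaf i) (path i)
      path-length : ∀ i → pathLength (path i) ≤ ℓ
      path-disjoint : ∀ i j → i ≢ j → ∀ x → x ∈ˡ path i → x ∈ˡ path j → x ≡ u

  Fan-mono : ∀ {t ℓ ℓ′ u} → ℓ ≤ ℓ′ → Fan t ℓ u → Fan t ℓ′ u
  Fan-mono ℓ≤ℓ′ F = record
    { Fan F hiding (path-length) ; path-length = λ i → ≤-trans (Fan.path-length F i) ℓ≤ℓ′ }

  FanWithLeavesIn : ℕ → ℕ → List (Fin n) → Set
  FanWithLeavesIn t ℓ xs = ∃ λ u → Σ (Fan t ℓ u) λ F → ∀ i → Fan.leaf F i ∈ˡ xs

  -- Choosing one lower neighbour for every vertex other than the root gives the parent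
  -- pointers of a spanning tree of height at most `height`.
  record SpanningTree (root : Fin n) (height : ℕ) : Set where
    field
      rank : Fin n → ℕ
      rank≤height : ∀ x → rank x ≤ height
      lower-neighbour : ∀ x → x ≢ root → ∃ λ y → Adj G y x × rank y < rank x

  -- The cap suc r exceeds every rank, so the walk attaining rank x really passes through x.
  spanningTree : ∀ {r} v → (∀ w → DistLe G v w r) → SpanningTree v r
  spanningTree {r} v reach = record
    { rank = rank ; rank≤height = rank≤r ; lower-neighbour = lower-neighbour }
    where
      walk : Fin n → List (Fin n)
      walk w = proj₁ (reach w)

      walk-isWalk : ∀ w → Walk G v w (walk w)
      walk-isWalk w = proj₁ (proj₁ (proj₂ (reach w)))

      cost : Fin n → Fin n → ℕ
      cost x w = position _≟_ (suc r) x (walk w)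

      nearest : Fin n → Fin n
      nearest x = argmin (cost x) x (allFin n)

      rank : Fin n → ℕ
      rank x = cost x (nearest x)

      rank-minimal : ∀ x w → rank x ≤ cost x w
      rank-minimal x w = All.lookup (f[argmin]≤f[xs] x (allFin n)) (∈-allFin w)

      rank≤r : ∀ x → rank x ≤ r
      rank≤r x = begin
        rank x               ≤⟨ rank-minimal x x ⟩
        cost x x             ≤⟨ ∸-monoˡ-≤ 1 (position<length _≟_ (suc r) (walk-last (walk-isWalk x))) ⟩
        pathLength (walk x)  ≤⟨ proj₂ (proj₂ (reach x)) ⟩
        r                    ∎
        where open ≤-Reasoning

      lower-neighbour : ∀ x → x ≢ v → ∃ λ y → Adj G y x × rank y < rank x
      lower-neighbour x x≢v with walk-predecessor (suc r) (walk-isWalk (nearest x)) x x≢v (s≤s (rank≤r x))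
      ... | y , y~x , earlier = y , y~x , ≤-<-trans (rank-minimal y (nearest x)) earlier

module TreePaths {n} {G : Graph n} {v h} (T : SpanningTree G v h) where
  open SpanningTree T

  parent : Fin n → Fin n
  parent x with x ≟ v
  ... | yes _ = x
  ... | no x≢v = proj₁ (lower-neighbour x x≢v)

  parent-lower : ∀ {x} → x ≢ v → Adj G (parent x) x × rank (parent x) < rank x
  parent-lower {x} x≢v with x ≟ v
  ... | yes x≡v = contradiction x≡v x≢v
  ... | no x≢v′ = proj₂ (lower-neighbour x x≢v′)

  data TreePath : Fin n → List (Fin n) → Set where
    root : TreePath v (v ∷ [])
    child : ∀ {x xs} → x ≢ v → TreePath (parent x) xs → TreePath x (xs ∷ʳ x)

  treePath-walk : ∀ {x xs} → TreePath x xs → Walk G v x xs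
  treePath-walk root = here v
  treePath-walk (child x≢v t) = walk-snoc G (treePath-walk t) (proj₁ (parent-lower x≢v))

  treePath-rank : ∀ {x xs} → TreePath x xs → All (λ y → rank y ≤ rank x) xs
  treePath-rank root = ≤-refl ∷ []
  treePath-rank (child x≢v t) =
    All.++⁺ (All.map (λ le → <⇒≤ (≤-<-trans le (proj₂ (parent-lower x≢v)))) (treePath-rank t))
            (≤-refl ∷ [])

  treePath-unique : ∀ {x xs} → TreePath x xs → Unique xs
  treePath-unique root = [] ∷ []
  treePath-unique (child x≢v t) = Unique.++⁺ (treePath-unique t) ([] ∷ [])
    λ { (x∈xs , here refl) → <⇒≱ (proj₂ (parent-lower x≢v)) (All.lookup (treePath-rank t) x∈xs) }

  treePath-length : ∀ {x xs} → TreePath x xs → length xs ≤ suc (rank x)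
  treePath-length root = s≤s z≤n
  treePath-length {x} (child {xs = xs} x≢v t) = begin
    length (xs ∷ʳ x)           ≡⟨ trans (length-++ xs) (+-comm _ 1) ⟩
    suc (length xs)            ≤⟨ s≤s (treePath-length t) ⟩
    suc (suc (rank (parent x))) ≤⟨ s≤s (proj₂ (parent-lower x≢v)) ⟩
    suc (rank x)               ∎
    where open ≤-Reasoning

  treePath-deterministic : ∀ {x xs ys} → TreePath x xs → TreePath x ys → xs ≡ ys
  treePath-deterministic root root = refl
  treePath-deterministic root (child v≢v _) = contradiction refl v≢v
  treePath-deterministic (child v≢v _) root = contradiction refl v≢v
  treePath-deterministic {x} (child _ t) (child _ t′) = cong (_∷ʳ x) (treePath-deterministic t t′)

  treePath-last : ∀ {x xs} → TreePath x xs → ∃ λ init → xs ≡ init ∷ʳ x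
  treePath-last root = [] , refl
  treePath-last (child {xs = xs} _ _) = xs , refl

  treePath-prefix : ∀ {x zs} pre {y} post → TreePath x zs → zs ≡ pre ++ y ∷ post → TreePath y (pre ∷ʳ y)
  treePath-prefix [] [] root refl = root
  treePath-prefix [] (_ ∷ _) root ()
  treePath-prefix (_ ∷ []) _ root ()
  treePath-prefix (_ ∷ _ ∷ _) _ root ()
  treePath-prefix pre post (child {xs = xs} x≢v t) eq with initLast post
  ... | [] with ∷ʳ-injective xs pre eq
  ...   | refl , refl = child x≢v t
  treePath-prefix pre {y} _ (child {xs = xs} x≢v t) eq | post ∷ʳ′ z =
    treePath-prefix pre post t (proj₁ (∷ʳ-injective xs (pre ++ y ∷ post)
      (trans eq (sym (++-assoc pre (y ∷ post) (z ∷ []))))))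

  treePath-exists : ∀ x → ∃ (TreePath x)
  treePath-exists x = go x (<-wellFounded (rank x))
    where
      go : ∀ x → Acc _<_ (rank x) → ∃ (TreePath x)
      go x (acc below) with x ≟ v
      ... | yes refl = v ∷ [] , root
      ... | no x≢v with go (parent x) (below (proj₂ (parent-lower x≢v)))
      ...   | xs , t = xs ∷ʳ x , child x≢v t

  treePath : Fin n → List (Fin n)
  treePath x = proj₁ (treePath-exists x)

  treePath-isTreePath : ∀ x → TreePath x (treePath x)
  treePath-isTreePath x = proj₂ (treePath-exists x)

  treePath-injective : ∀ {x y} → treePath x ≡ treePath y → x ≡ y
  treePath-injective {x} {y} eq
    with treePath-last (treePath-isTreePath x) | treePath-last (treePath-isTreePath y)
  ... | init , ex | init′ , ey = proj₂ (∷ʳ-injective init init′ (trans (sym ex) (trans eq ey)))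

  treePath-prefix-closed : ∀ {x} pre {y} post → treePath x ≡ pre ++ y ∷ post → treePath y ≡ pre ∷ʳ y
  treePath-prefix-closed {x} pre {y} post eq = treePath-deterministic (treePath-isTreePath y)
    (treePath-prefix pre post (treePath-isTreePath x) eq)

  record Descendant (k : ℕ) (u s : Fin n) : Set where
    constructor descendant
    field
      rest : List (Fin n)
      treePath≡ : treePath s ≡ treePath u ++ rest
      rest-length : length rest ≤ k

  root-descendant : ∀ s → Descendant h v s
  root-descendant s with walk-head G (treePath-walk (treePath-isTreePath s))
  ... | rest , eq = descendant rest (trans eq (cong (_++ rest) (sym treePath-v)))
                    (≤-trans (s≤s⁻¹ (subst (λ xs → length xs ≤ suc (rank s)) eq
                                           (treePath-length (treePath-isTreePath s))))
                            (rank≤height s))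
    where
      treePath-v : treePath v ≡ v ∷ []
      treePath-v = treePath-deterministic (treePath-isTreePath v) root

  -- The child of u on the tree path to s; meaningless unless s is a proper descendant of u.
  branch : Fin n → Fin n → Fin n
  branch u s = fromMaybe s (head (drop (length (treePath u)) (treePath s)))

  branch-of : ∀ {u s} c rest → treePath s ≡ treePath u ++ c ∷ rest → branch u s ≡ c
  branch-of {u} {s} c rest eq =
    cong (fromMaybe s ∘ head) (trans (cong (drop (length (treePath u))) eq) (drop-length-++ (treePath u)))

  below-prefix : ∀ {u s x} pre post →
                 treePath s ≡ treePath u ++ pre ++ x ∷ post → treePath x ≡ treePath u ++ pre ∷ʳ x
  below-prefix {u} {s} {x} pre post eq = trans
    (treePath-prefix-closed {s} (treePath u ++ pre) post
      (trans eq (sym (++-assoc (treePath u) pre (x ∷ post)))))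
    (++-assoc (treePath u) pre (x ∷ []))

  branch-constant : ∀ {u s x} pre post →
                    treePath s ≡ treePath u ++ pre ++ x ∷ post → branch u x ≡ branch u s
  branch-constant {u} {s} {x} [] post eq =
    trans (branch-of {u} x [] (below-prefix {u} {s} [] post eq))
          (sym (branch-of {u} {s} x post eq))
  branch-constant {u} {s} {x} (c ∷ pre) post eq =
    trans (branch-of {u} c (pre ∷ʳ x) (below-prefix {u} {s} (c ∷ pre) post eq))
          (sym (branch-of {u} {s} c (pre ++ x ∷ post) eq))

  descendant-zero : ∀ {u s} → Descendant 0 u s → s ≡ u
  descendant-zero {u} (descendant [] eq _) = treePath-injective (trans eq (++-identityʳ (treePath u)))

  descendant-child : ∀ {k u s} → Descendant (suc k) u s → s ≢ u → Descendant k (branch u s) s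
  descendant-child (descendant [] eq _) s≢u =
    contradiction (descendant-zero (descendant [] eq z≤n)) s≢u
  descendant-child {k} {u} {s} (descendant (c ∷ rest) eq len) _ =
    subst (λ c → Descendant k c s) (sym (branch-of {u} c rest eq)) (descendant rest eq′ (s≤s⁻¹ len))
    where
      open ≡-Reasoning
      eq′ : treePath s ≡ treePath c ++ rest
      eq′ = begin
        treePath s              ≡⟨ eq ⟩
        treePath u ++ c ∷ rest  ≡⟨ ++-assoc (treePath u) (c ∷ []) rest ⟨
        (treePath u ∷ʳ c) ++ rest ≡⟨ cong (_++ rest) (treePath-prefix-closed {s} (treePath u) rest eq) ⟨
        treePath c ++ rest      ∎

  descendant-isPath : ∀ {u s} rest → treePath s ≡ treePath u ++ rest → IsPath G u s (u ∷ rest)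
  descendant-isPath {u} {s} rest eq with treePath-last (treePath-isTreePath u)
  ... | init , eu =
    isPath-suffix G init (subst (IsPath G v s) eq′ (treePath-walk t , treePath-unique t))
    where
      t = treePath-isTreePath s
      eq′ : treePath s ≡ init ++ u ∷ rest
      eq′ = trans eq (trans (cong (_++ rest) eu) (++-assoc init (u ∷ []) rest))

  fan-from-branches : ∀ {t k u} (leaf : Fin t → Fin n) → (∀ i → leaf i ≢ u) →
                      (∀ i → Descendant k u (leaf i)) → Injective _≡_ _≡_ (branch u ∘ leaf) →
                      Fan G t k u
  fan-from-branches {u = u} leaf leaf≢u below distinct = record
    { leaf = leaf
    ; path = λ i → u ∷ rest i
    ; leaf-injective = distinct ∘ cong (branch u)
    ; leaf≢centre = leaf≢u
    ; path-isPath = λ i → descendant-isPath (rest i) (Descendant.treePath≡ (below i))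
    ; path-length = λ i → Descendant.rest-length (below i)
    ; path-disjoint = disjoint
    }
    where
      rest = λ i → Descendant.rest (below i)

      same-branch : ∀ i {x} → x ∈ˡ rest i → branch u x ≡ branch u (leaf i)
      same-branch i x∈ with ∈-∃++ x∈
      ... | pre , post , split = branch-constant {u} {leaf i} pre post
                                   (trans (Descendant.treePath≡ (below i)) (cong (treePath u ++_) split))

      disjoint : ∀ i j → i ≢ j → ∀ x → x ∈ˡ u ∷ rest i → x ∈ˡ u ∷ rest j → x ≡ u
      disjoint _ _ _ _ (here x≡u) _ = x≡u
      disjoint _ _ _ _ (there _) (here x≡u) = x≡u
      disjoint i j i≢j _ (there x∈i) (there x∈j) =
        contradiction (distinct (trans (sym (same-branch i x∈i)) (same-branch j x∈j))) i≢j

  fan-below : ∀ j k u xs → Unique xs → All (Descendant k u) xs → suc j ^ k < length xs →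
              FanWithLeavesIn G (suc j) k xs
  fan-below j zero u (s₁ ∷ s₂ ∷ _) ((s₁≢s₂ ∷ _) ∷ _) (d₁ ∷ d₂ ∷ _) _ =
    contradiction (trans (descendant-zero d₁) (sym (descendant-zero d₂))) s₁≢s₂
  fan-below j zero u [] _ _ ()
  fan-below j zero u (_ ∷ []) _ _ (s≤s ())
  fan-below j (suc k) u xs uniq below lt = conclude (pigeonhole j (suc j ^ k) others enough)
    where
      open Pigeonhole _≟_ (branch u)

      others = filter (λ s → ¬? (s ≟ u)) xs

      others⊆ : ∀ {s} → s ∈ˡ others → s ∈ˡ xs × s ≢ u
      others⊆ = ∈-filter⁻ (λ s → ¬? (s ≟ u))

      enough : j * suc j ^ k < length others
      enough = begin-strict
        j * suc j ^ k  <⟨ m<n+m _ (m^n>0 (suc j) k) ⟩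
        suc j ^ suc k  ≤⟨ s≤s⁻¹ (≤-trans lt (length-filter-≢ _≟_ u uniq)) ⟩
        length others  ∎
        where open ≤-Reasoning

      class⊆ : ∀ c {s} → s ∈ˡ class c others → s ∈ˡ xs × Descendant k c s
      class⊆ c s∈ with ∈-filter⁻ (λ s → branch u s ≟ c) s∈
      ... | s∈others , refl with others⊆ s∈others
      ...   | s∈xs , s≢u = s∈xs , descendant-child (All.lookup below s∈xs) s≢u

      conclude : LargeClass (suc j ^ k) others ⊎ DistinctKeys (suc j) others →
                 FanWithLeavesIn G (suc j) (suc k) xs
      conclude (inj₁ (c , large))
        with fan-below j k c (class c others) (Unique.filter⁺ _ (Unique.filter⁺ _ uniq))
                       (All.tabulate (proj₂ ∘ class⊆ c)) large
      ... | w , F , leaf∈ = w , Fan-mono G (n≤1+n k) F , proj₁ ∘ class⊆ c ∘ leaf∈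
      conclude (inj₂ (g , g∈ , distinct)) =
        u , fan-from-branches g (proj₂ ∘ others⊆ ∘ g∈) (All.lookup below ∘ proj₁ ∘ others⊆ ∘ g∈)
                              distinct ,
        proj₁ ∘ others⊆ ∘ g∈

fan-from-radius : ∀ {n} (G : Graph n) j r → RadiusLe G r → (xs : List (Fin n)) → Unique xs →
                  suc j ^ r < length xs → FanWithLeavesIn G (suc j) r xs
fan-from-radius G j r (v , reach) xs uniq large =
  fan-below j r v xs uniq (All.universal root-descendant xs) large
  where open TreePaths (spanningTree G v reach)

elements : ∀ {n} → Subset n → List (Fin n)
elements [] = []
elements (inside ∷ p) = zero ∷ map suc (elements p)
elements (outside ∷ p) = map suc (elements p)

elements-length : ∀ {n} (p : Subset n) → length (elements p) ≡ ∣ p ∣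
elements-length [] = refl
elements-length (inside ∷ p) = cong suc (trans (length-map suc (elements p)) (elements-length p))
elements-length (outside ∷ p) = trans (length-map suc (elements p)) (elements-length p)

elements-unique : ∀ {n} (p : Subset n) → Unique (elements p)
elements-unique [] = []
elements-unique (inside ∷ p) =
  All.map⁺ (All.universal (λ _ ()) (elements p)) ∷ Unique.map⁺ suc-injective (elements-unique p)
elements-unique (outside ∷ p) = Unique.map⁺ suc-injective (elements-unique p)

∈-elements : ∀ {n} (p : Subset n) {x} → x ∈ˡ elements p → x ∈ p
∈-elements (inside ∷ p) (here refl) = here
∈-elements (inside ∷ p) (there x∈) with ∈-map⁻ suc x∈
... | y , y∈ , refl = there (∈-elements p y∈)
∈-elements (outside ∷ p) x∈ with ∈-map⁻ suc x∈
... | y , y∈ , refl = there (∈-elements p y∈)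

lemma4p2 : (r t n : ℕ) (G : Graph n) → RadiusLe G r → (S : Subset n) → t ^ r + 1 ≤ ∣ S ∣ →
    Σ (Fin n) λ u → Σ (Fin t → Fin n) λ f → Σ (Fin t → List (Fin n)) λ P →
      Injective _≡_ _≡_ f
      × ((i : Fin t) → f i ∈ S)
      × ((i : Fin t) → f i ≢ u)
      × ((i : Fin t) → IsPath G u (f i) (P i) × pathLength (P i) ≤ r)
      × ((i j : Fin t) → i ≢ j → (x : Fin n) → x ∈ˡ P i → x ∈ˡ P j → x ≡ u)
lemma4p2 r zero n G (v , _) S _ = v , (λ ()) , (λ ()) , (λ { {()} }) , (λ ()) , (λ ()) , (λ ()) , (λ ())
lemma4p2 r (suc j) n G radius S large
  with fan-from-radius G j r radius (elements S) (elements-unique S)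
         (subst (suc j ^ r <_) (sym (elements-length S)) (subst (_≤ ∣ S ∣) (+-comm (suc j ^ r) 1) large))
... | u , F , leaf∈ =
  u , leaf , path , leaf-injective , ∈-elements S ∘ leaf∈ , leaf≢centre ,
  (λ i → path-isPath i , path-length i) , path-disjoint
  where open Fan F
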